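{- Let $L'$ be a Latin square and let $L$ be a near copy of $L'$ with associated alien entry $\pi$. Let $T$ be a submatrix of $L$ that does not contain $\pi$. Suppose that $T$ is a $k$-near copy of some $N_\infty$ Latin square $N$, where $k\in\{0,1,2\}$. Suppose further that no symbol of an entry of $T$ that is alien with respect to $N$ is native to $T$. Also suppose that $L$ has a subsquare $S$ that meets $T$ in at least two entries. Let $V=S\cap T$ and suppose that (a) $V$ has more than $k$ columns, and (b) $V$ intersects a row $r$ of $L$ that contains none of the holes in $T$ with respect to $N$. Then one of the following is true: (1) $V=T$; (2) $V$ has exactly $k$ rows and $k+1$ columns; (3) $k=2$, and the two alien entries of $T$ with respect to $N$ are $(x_1,y_1,\sigma_1)\in V$ and $(x_2,y_2,\sigma_2)\notin V$; the shadow of $V$ in $N$ is a subsquare of the matrix $\nu\hookrightarrow N[x_1,y_1]$, where $\nu$ is the displaced native from $(x_2,y_2)$; and either $x_1=x_2$ and $\pi$ is in column $y_1$, or $y_1=y_2$ and $\pi$ is in row $x_1$.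
   Context: Matrices are viewed as sets of entries (triples (row, column, symbol)); an entry $(i,j,k)$ lies in cell $(i,j)$. A Latin square of order $n$ is an $n\times n$ matrix on $n$ symbols with each symbol exactly once in each row and column. A subsquare of order $k$ of a matrix is a $k\times k$ submatrix (on any $k$ rows and $k$ columns) that is a Latin square; an $N_\infty$ Latin square of order $n$ is one with no subsquare of order in $\{2,\dots,n-1\}$. For a submatrix $X$ with row set $R$ and column set $C$, $X$ is indexed by $R$ and $C$. For a matrix $L$, distinct cells $(x_i,y_i)$, $i\in[k]$, and symbols $\sigma_i\neq L[x_i,y_i]$ (possibly not among the symbols of $L$), the matrix obtained from $L$ by replacing each entry $(x_i,y_i,L[x_i,y_i])$ with $(x_i,y_i,\sigma_i)$ is a $k$-near copy of $L$ (a $1$-near copy is a near copy; $L$ is a $0$-near copy of itself). In such a $k$-near copy $L^*$ of $L$: the entries $(x_i,y_i,\sigma_i)$ are the alien entries (with respect to $L$), all other entries are native entries, and their symbols are native symbols; the cells $(x_i,y_i)$ are the holes; and $L[x_i,y_i]$ is the displaced native from the hole $(x_i,y_i)$. If $T$ is a submatrix of $L^*$, these notions are applied to $T$ by restricting to the entries of $T$ (e.g. the native symbols of $T$ are the symbols of native entries lying in $T$). The notation $\sigma\hookrightarrow L[i,j]$ denotes the near copy of $L$ obtained by replacing the symbol in cell $(i,j)$ by $\sigma$. If $S$ is a set of entries of a matrix in cells that are also cells of a matrix $N$, the shadow of $S$ in $N$ is $\{(i,j,N[i,j]):(i,j,\cdot)\in S\}$. For a subsquare $S$ and submatrix $T$,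 $S\cap T$ is the set of entries common to both, and its rows/columns are the rows/columns of these entries. -}

module Defs where

open import Data.Nat using (ℕ; zero; suc; _≤_; _<_)
open import Data.Fin using (Fin; _≟_)
open import Data.Fin.Subset using (Subset; _∈_; _⊆_; ∣_∣)
open import Data.Product using (Σ; ∃; _×_; _,_)
open import Relation.Binary.PropositionalEquality using (_≡_; _≢_)
open import Relation.Nullary using (¬_; yes; no)
open import Function.Definitions using (Injective)

-- A matrix in the paper's sense (a set of entries) is a submatrix of such an
-- array, given by a row set R and a column set C (subsets of Fin n).
Matrix : ℕ → Set
Matrix n = Fin n → Fin n → ℕ

IsLatinOn : ∀ {n} → Matrix n → Subset n → Subset n → Set
IsLatinOn M R C =
  ∣ R ∣ ≡ ∣ C ∣ ×
  Σ (Fin ∣ R ∣ → ℕ) λ sym →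
    Injective _≡_ _≡_ sym ×
    (∀ i j → i ∈ R → j ∈ C → ∃ λ s → M i j ≡ sym s) ×
    (∀ i s → i ∈ R → ∃ λ j → j ∈ C × M i j ≡ sym s) ×
    (∀ j s → j ∈ C → ∃ λ i → i ∈ R × M i j ≡ sym s) ×
    (∀ i j j′ → i ∈ R → j ∈ C → j′ ∈ C → M i j ≡ M i j′ → j ≡ j′) ×
    (∀ i i′ j → i ∈ R → i′ ∈ R → j ∈ C → M i j ≡ M i′ j → i ≡ i′)

IsNInfinityOn : ∀ {n} → Matrix n → Subset n → Subset n → Set
IsNInfinityOn N R C =
  ∀ R′ C′ → R′ ⊆ R → C′ ⊆ C → 2 ≤ ∣ R′ ∣ → suc ∣ R′ ∣ ≤ ∣ R ∣ →
  ¬ IsLatinOn N R′ C′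

-- L is a near copy of L′ with the unique hole at cell (a , b):
-- the alien entry is (a , b , L a b).
IsNearCopyAt : ∀ {n} → Matrix n → Matrix n → Fin n → Fin n → Set
IsNearCopyAt L L′ a b =
  L a b ≢ L′ a b × (∀ i j → ¬ (i ≡ a × j ≡ b) → L i j ≡ L′ i j)

Hole : ∀ {n} → Matrix n → Matrix n → Subset n → Subset n → Fin n → Fin n → Set
Hole L N R C i j = i ∈ R × j ∈ C × L i j ≢ N i j

IsKNearCopyOn : ∀ {n} → Matrix n → Matrix n → Subset n → Subset n → ℕ → Set
IsKNearCopyOn {n} L N R C k =
  Σ (Fin k → Fin n × Fin n) λ h →
    Injective _≡_ _≡_ h ×
    (∀ i j → Hole L N R C i j → ∃ λ t → h t ≡ (i , j)) ×
    (∀ i j t → h t ≡ (i , j) → Hole L N R C i j)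

NoAlienSymbolNative : ∀ {n} → Matrix n → Matrix n → Subset n → Subset n → Set
NoAlienSymbolNative L N R C =
  ∀ i j i′ j′ → Hole L N R C i j → i′ ∈ R → j′ ∈ C → ¬ Hole L N R C i′ j′ →
  L i j ≢ L i′ j′

-- σ ↪ M[x , y]: replace the symbol in cell (x , y) by σ.
update : ∀ {n} → Matrix n → Fin n → Fin n → ℕ → Matrix n
update M x y σ i j with i ≟ x | j ≟ y
... | yes _ | yes _ = σ
... | _     | _     = M i j

module Submission where

-- Write V = S ∩ T and fix the hole-free row r of V. A native symbol of V missing from a line of V
-- still occurs in that line of S and of N; as L agrees with the Latin square L′ away from π, the
-- two occurrences are the same cell unless it is π or a hole of T. Every such deficiency is thus
-- charged to one of the k + 1 sources π and the holes. With fewer rows than columns, each column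
-- of V misses a symbol of row r, so ∣ CV ∣ ≤ k + 1, which leaves case (2) (a single row would
-- need four sources). Fewer columns than rows is impossible by the dual count along a hole-free
-- column. If V is square and, within the rows of V, N never moves a symbol of row r outside the
-- columns of S, then N is Latin on V and V = T since N is N∞. Otherwise such a symbol σ escapes
-- from a row i₀ of V; chasing σ through row i₀ and a column j of V lacking it uses up both holes,
-- and updating N at (i₀ , j) gives the subsquare of case (3).

open import Defs
open import Data.Empty using (⊥; ⊥-elim)
open import Data.Fin using (Fin; zero; suc; cast; inject≤) renaming (_≟_ to _≟ᶠ_)
open import Data.Fin.Properties
  using (any?; injective⇒≤; inject≤-injective; cast-involutive) renaming (suc-injective to fsuc-injective)
open import Data.Fin.Subset using (Subset; _∈_; _∉_; _∩_; _-_; _⊆_; ∣_∣; ⊤; inside; outside)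
open import Data.Fin.Subset.Properties
  using (_∈?_; ∈⊤; ∣⊤∣≡n; x∈p∩q⁺; p∩q⊆p; p∩q⊆q; p─q⊆p; x∈p∧x≢y⇒x∈p-y; x∈p⇒∣p-x∣<∣p∣;
         p⊆q⇒∣p∣≤∣q∣; ⊆-antisym; x∈⁅y⁆⇒x≡y; ∣⁅x⁆∣≡1)
open import Data.Nat using (ℕ; zero; suc; _≤_; _<_; _*_; z≤n; s≤s) renaming (_≟_ to _≟ⁿ_)
open import Data.Nat.Properties using (≤-trans; <-≤-trans; ≤-reflexive; ≤-antisym; ≤-pred; <⇒≱; <-cmp; _≤?_; ≰⇒>)
open import Data.Product using (Σ; ∃; _×_; _,_; proj₁; proj₂; uncurry)
open import Data.Product.Properties using (,-injective)
open import Data.Sum using (_⊎_; inj₁; inj₂)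
open import Data.Vec.Base using (_∷_; []; here; there)
open import Function using (_∘_)
open import Function.Definitions using (Injective)
open import Relation.Binary using (tri<; tri≈; tri>)
open import Relation.Binary.PropositionalEquality using (_≡_; _≢_; refl; sym; trans; cong; subst)
open import Relation.Nullary using (¬_; Dec; yes; no; contradiction)
open import Relation.Nullary.Decidable using (_×-dec_; ¬?; decidable-stable)

-- Opaque, like the search in Leaking below: unfolding a search into the witness it returns makes
-- typechecking the uses of that witness very slow.
opaque
  all-or-counterexample : ∀ {n} {P : Fin n → Set} (p : Subset n) → (∀ x → Dec (P x)) →
                          (∀ {x} → x ∈ p → P x) ⊎ ∃ λ x → x ∈ p × ¬ P x
  all-or-counterexample p P? with any? (λ x → (x ∈? p) ×-dec ¬? (P? x))
  ... | yes counterexample = inj₂ counterexample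
  ... | no none = inj₁ λ {x} x∈p → decidable-stable (P? x) (λ ¬Px → none (x , x∈p , ¬Px))

Injects : ∀ {m n} → (Fin m → Fin n → Set) → Subset m → Subset n → Set
Injects R p q =
  (∀ {x} → x ∈ p → ∃ λ y → y ∈ q × R x y) ×
  (∀ {x x′ y} → x ∈ p → x′ ∈ p → y ∈ q → R x y → R x′ y → x ≡ x′)

Injects⇒∣p∣≤∣q∣ : ∀ {m n} {R : Fin m → Fin n → Set} {p q} → Injects R p q → ∣ p ∣ ≤ ∣ q ∣
Injects⇒∣p∣≤∣q∣ {p = []} _ = z≤n
Injects⇒∣p∣≤∣q∣ {R = R} {outside ∷ p} {q} (total , inj) =
  Injects⇒∣p∣≤∣q∣ {R = R ∘ suc} {p} {q}
    ((λ x∈p → total (there x∈p)) ,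
     λ x∈p x′∈p y∈q u v → fsuc-injective (inj (there x∈p) (there x′∈p) y∈q u v))
Injects⇒∣p∣≤∣q∣ {R = R} {inside ∷ p} {q} (total , inj) with total here
... | y , y∈q , R0y =
  ≤-trans (s≤s (Injects⇒∣p∣≤∣q∣ {R = R ∘ suc} {p} {q - y} (total′ , inj′))) (x∈p⇒∣p-x∣<∣p∣ y∈q)
  where
  total′ : ∀ {x} → x ∈ p → ∃ λ z → z ∈ q - y × R (suc x) z
  total′ x∈p with total (there x∈p)
  ... | z , z∈q , Rxz =
    z , x∈p∧x≢y⇒x∈p-y z∈q (λ { refl → contradiction (inj here (there x∈p) z∈q R0y Rxz) λ () }) , Rxz
  inj′ : ∀ {x x′ z} → x ∈ p → x′ ∈ p → z ∈ q - y → R (suc x) z → R (suc x′) z → x ≡ x′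
  inj′ x∈p x′∈p z∈q-y u v = fsuc-injective (inj (there x∈p) (there x′∈p) (p─q⊆p _ _ z∈q-y) u v)

Injects⇒∣p∣≤n : ∀ {m n} {R : Fin m → Fin n → Set} {p} → Injects R p ⊤ → ∣ p ∣ ≤ n
Injects⇒∣p∣≤n {n = n} p↣⊤ = subst (_ ≤_) (∣⊤∣≡n n) (Injects⇒∣p∣≤∣q∣ p↣⊤)

Injects⇒onto : ∀ {m n} {R : Fin m → Fin n → Set} {p q} → (∀ x y → Dec (R x y)) →
               Injects R p q → ∣ q ∣ ≤ ∣ p ∣ → ∀ {y} → y ∈ q → ∃ λ x → x ∈ p × R x y
Injects⇒onto {R = R} {p} {q} R? (total , inj) q≤p {y} y∈q with any? (λ x → (x ∈? p) ×-dec R? x y)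
... | yes hit = hit
... | no miss =
  contradiction (Injects⇒∣p∣≤∣q∣ (total′ , λ x∈p x′∈p z∈ → inj x∈p x′∈p (p─q⊆p _ _ z∈)))
                (<⇒≱ (<-≤-trans (x∈p⇒∣p-x∣<∣p∣ y∈q) q≤p))
  where
  total′ : ∀ {x} → x ∈ p → ∃ λ z → z ∈ q - y × R x z
  total′ {x} x∈p with total x∈p
  ... | z , z∈q , Rxz = z , x∈p∧x≢y⇒x∈p-y z∈q (λ { refl → miss (x , x∈p , Rxz) }) , Rxz

⊆∧∣q∣≤∣p∣⇒p≡q : ∀ {n} {p q : Subset n} → p ⊆ q → ∣ q ∣ ≤ ∣ p ∣ → p ≡ q
⊆∧∣q∣≤∣p∣⇒p≡q {p = p} {q} p⊆q q≤p = ⊆-antisym p⊆q q⊆p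
  where
  q⊆p : q ⊆ p
  q⊆p y∈q with Injects⇒onto _≟ᶠ_ ((λ x∈p → _ , p⊆q x∈p , refl) , λ _ _ _ e e′ → trans e (sym e′)) q≤p y∈q
  ... | _ , x∈p , refl = x∈p

∣p∣≤1⇒≡ : ∀ {n} {p : Subset n} {x y} → ∣ p ∣ ≤ 1 → x ∈ p → y ∈ p → x ≡ y
∣p∣≤1⇒≡ {p = p} {x} {y} p≤1 x∈p y∈p = decidable-stable (x ≟ᶠ y) λ x≢y →
  <⇒≱ (≤-trans (s≤s (1≤∣p-x∣ x≢y)) (x∈p⇒∣p-x∣<∣p∣ x∈p)) p≤1
  where
  1≤∣p-x∣ : x ≢ y → 1 ≤ ∣ p - x ∣
  1≤∣p-x∣ x≢y = subst (_≤ ∣ p - x ∣) (∣⁅x⁆∣≡1 y) (p⊆q⇒∣p∣≤∣q∣ λ z∈⁅y⁆ →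
    subst (_∈ p - x) (sym (x∈⁅y⁆⇒x≡y y z∈⁅y⁆)) (x∈p∧x≢y⇒x∈p-y y∈p (x≢y ∘ sym)))

index : ∀ {n} (p : Subset n) → Fin ∣ p ∣ → Fin n
index (inside ∷ p) zero = zero
index (inside ∷ p) (suc t) = suc (index p t)
index (outside ∷ p) t = suc (index p t)

index∈ : ∀ {n} (p : Subset n) t → index p t ∈ p
index∈ (inside ∷ p) zero = here
index∈ (inside ∷ p) (suc t) = there (index∈ p t)
index∈ (outside ∷ p) t = there (index∈ p t)

index-injective : ∀ {n} (p : Subset n) → Injective _≡_ _≡_ (index p)
index-injective (inside ∷ p) {zero} {zero} _ = refl
index-injective (inside ∷ p) {suc t} {suc u} e = cong suc (index-injective p (fsuc-injective e))
index-injective (outside ∷ p) e = index-injective p (fsuc-injective e)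

index-surjective : ∀ {n} (p : Subset n) {x} → x ∈ p → ∃ λ t → index p t ≡ x
index-surjective (inside ∷ p) here = zero , refl
index-surjective (inside ∷ p) (there x∈p) with index-surjective p x∈p
... | t , e = suc t , cong suc e
index-surjective (outside ∷ p) (there x∈p) with index-surjective p x∈p
... | t , e = t , cong suc e

distinct-elements : ∀ {m n} {p : Subset n} → m ≤ ∣ p ∣ →
                    Σ (Fin m → Fin n) λ f → (∀ i → f i ∈ p) × Injective _≡_ _≡_ f
distinct-elements {p = p} m≤p =
  (λ i → index p (inject≤ i m≤p)) , (λ i → index∈ p _) ,
  λ e → inject≤-injective m≤p m≤p _ _ (index-injective p e)

2≤∣p∣⇒∃≢ : ∀ {n} {p : Subset n} → 2 ≤ ∣ p ∣ → ∀ y → ∃ λ x → x ∈ p × x ≢ y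
2≤∣p∣⇒∃≢ 2≤p y with distinct-elements 2≤p
... | f , f∈p , f-injective with f zero ≟ᶠ y
...   | no f₀≢y = f zero , f∈p zero , f₀≢y
...   | yes refl = f (suc zero) , f∈p (suc zero) , λ f₁≡f₀ → contradiction (f-injective f₁≡f₀) λ ()

four-distinct⇒4≤n : ∀ {n} (w₁ w₂ w₃ w₄ : Fin n) →
  w₁ ≢ w₂ → w₁ ≢ w₃ → w₁ ≢ w₄ → w₂ ≢ w₃ → w₂ ≢ w₄ → w₃ ≢ w₄ → 4 ≤ n
four-distinct⇒4≤n {n} w₁ w₂ w₃ w₄ d₁₂ d₁₃ d₁₄ d₂₃ d₂₄ d₃₄ = injective⇒≤ {f = w} w-injective
  where
  w : Fin 4 → Fin n
  w zero = w₁
  w (suc zero) = w₂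
  w (suc (suc zero)) = w₃
  w (suc (suc (suc zero))) = w₄
  w-injective : Injective _≡_ _≡_ w
  w-injective {zero} {zero} _ = refl
  w-injective {suc zero} {suc zero} _ = refl
  w-injective {suc (suc zero)} {suc (suc zero)} _ = refl
  w-injective {suc (suc (suc zero))} {suc (suc (suc zero))} _ = refl
  w-injective {zero} {suc zero} e = ⊥-elim (d₁₂ e)
  w-injective {zero} {suc (suc zero)} e = ⊥-elim (d₁₃ e)
  w-injective {zero} {suc (suc (suc zero))} e = ⊥-elim (d₁₄ e)
  w-injective {suc zero} {suc (suc zero)} e = ⊥-elim (d₂₃ e)
  w-injective {suc zero} {suc (suc (suc zero))} e = ⊥-elim (d₂₄ e)
  w-injective {suc (suc zero)} {suc (suc (suc zero))} e = ⊥-elim (d₃₄ e)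
  w-injective {suc zero} {zero} e = ⊥-elim (d₁₂ (sym e))
  w-injective {suc (suc zero)} {zero} e = ⊥-elim (d₁₃ (sym e))
  w-injective {suc (suc (suc zero))} {zero} e = ⊥-elim (d₁₄ (sym e))
  w-injective {suc (suc zero)} {suc zero} e = ⊥-elim (d₂₃ (sym e))
  w-injective {suc (suc (suc zero))} {suc zero} e = ⊥-elim (d₂₄ (sym e))
  w-injective {suc (suc (suc zero))} {suc (suc zero)} e = ⊥-elim (d₃₄ (sym e))

two-distinct⇒covering : ∀ {k} → k ≤ 2 → (t₁ t₂ t : Fin k) → t₁ ≢ t₂ → t ≡ t₁ ⊎ t ≡ t₂
two-distinct⇒covering (s≤s (s≤s z≤n)) zero (suc zero) zero _ = inj₁ refl
two-distinct⇒covering (s≤s (s≤s z≤n)) zero (suc zero) (suc zero) _ = inj₂ refl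
two-distinct⇒covering (s≤s (s≤s z≤n)) (suc zero) zero zero _ = inj₂ refl
two-distinct⇒covering (s≤s (s≤s z≤n)) (suc zero) zero (suc zero) _ = inj₁ refl
two-distinct⇒covering _ zero zero _ t₁≢t₂ = ⊥-elim (t₁≢t₂ refl)
two-distinct⇒covering (s≤s (s≤s z≤n)) (suc zero) (suc zero) _ t₁≢t₂ = ⊥-elim (t₁≢t₂ refl)

two-distinct⇒k≡2 : ∀ {k} → k ≤ 2 → (t₁ t₂ : Fin k) → t₁ ≢ t₂ → k ≡ 2
two-distinct⇒k≡2 k≤2 t₁ t₂ t₁≢t₂ = ≤-antisym k≤2 (injective⇒≤ {f = pair} pair-injective)
  where
  pair : Fin 2 → Fin _
  pair zero = t₁
  pair (suc zero) = t₂
  pair-injective : Injective _≡_ _≡_ pair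
  pair-injective {zero} {zero} _ = refl
  pair-injective {suc zero} {suc zero} _ = refl
  pair-injective {zero} {suc zero} e = ⊥-elim (t₁≢t₂ e)
  pair-injective {suc zero} {zero} e = ⊥-elim (t₁≢t₂ (sym e))

2≤s*suc[k]⇒s≡k : ∀ s k → s ≤ k → k ≤ 2 → 2 ≤ s * suc k → s ≡ k ⊎ (s ≡ 1 × k ≡ 2)
2≤s*suc[k]⇒s≡k 1 1 _ _ _ = inj₁ refl
2≤s*suc[k]⇒s≡k 2 2 _ _ _ = inj₁ refl
2≤s*suc[k]⇒s≡k 1 2 _ _ _ = inj₂ (refl , refl)
2≤s*suc[k]⇒s≡k 0 _ _ _ ()
2≤s*suc[k]⇒s≡k 1 0 () _ _
2≤s*suc[k]⇒s≡k 2 (suc zero) (s≤s ()) _ _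
2≤s*suc[k]⇒s≡k (suc (suc (suc _))) _ (s≤s (s≤s (s≤s _))) (s≤s (s≤s ())) _
2≤s*suc[k]⇒s≡k (suc (suc _)) 0 () _ _
2≤s*suc[k]⇒s≡k (suc _) (suc (suc (suc _))) _ (s≤s (s≤s ())) _

2≤s*s⇒2≤s : ∀ s → 2 ≤ s * s → 2 ≤ s
2≤s*s⇒2≤s (suc (suc s)) _ = s≤s (s≤s z≤n)
2≤s*s⇒2≤s 1 (s≤s ())

RowInjectiveOn ColInjectiveOn : ∀ {n} → Matrix n → Subset n → Subset n → Set
RowInjectiveOn M R C = ∀ {i j j′} → i ∈ R → j ∈ C → j′ ∈ C → M i j ≡ M i j′ → j ≡ j′
ColInjectiveOn M R C = ∀ {i i′ j} → i ∈ R → i′ ∈ R → j ∈ C → M i j ≡ M i′ j → i ≡ i′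

OccursInRow : ∀ {n} → Matrix n → Fin n → Subset n → ℕ → Set
OccursInRow M i C σ = ∃ λ j → j ∈ C × M i j ≡ σ

OccursInCol : ∀ {n} → Matrix n → Fin n → Subset n → ℕ → Set
OccursInCol M j R σ = ∃ λ i → i ∈ R × M i j ≡ σ

occursInRow? : ∀ {n} (M : Matrix n) i C σ → Dec (OccursInRow M i C σ)
occursInRow? M i C σ = any? λ j → (j ∈? C) ×-dec (M i j ≟ⁿ σ)

occursInCol? : ∀ {n} (M : Matrix n) j R σ → Dec (OccursInCol M j R σ)
occursInCol? M j R σ = any? λ i → (i ∈? R) ×-dec (M i j ≟ⁿ σ)

module Latin {n} {M : Matrix n} {R C : Subset n} (lat : IsLatinOn M R C) where

  row-injective : RowInjectiveOn M R C
  row-injective {i} {j} {j′} = let (_ , _ , _ , _ , _ , _ , rowInj , _) = lat in rowInj i j j′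

  col-injective : ColInjectiveOn M R C
  col-injective {i} {i′} {j} = let (_ , _ , _ , _ , _ , _ , _ , colInj) = lat in colInj i i′ j

  row-injective-⊆ : ∀ {R′ C′} → R′ ⊆ R → C′ ⊆ C → RowInjectiveOn M R′ C′
  row-injective-⊆ R′⊆R C′⊆C i∈ j∈ j′∈ = row-injective (R′⊆R i∈) (C′⊆C j∈) (C′⊆C j′∈)

  col-injective-⊆ : ∀ {R′ C′} → R′ ⊆ R → C′ ⊆ C → ColInjectiveOn M R′ C′
  col-injective-⊆ R′⊆R C′⊆C i∈ i′∈ j∈ = col-injective (R′⊆R i∈) (R′⊆R i′∈) (C′⊆C j∈)

  row-contains : ∀ {i p q} → i ∈ R → p ∈ R → q ∈ C → OccursInRow M i C (M p q)
  row-contains {i} {p} {q} i∈ p∈ q∈ =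
    let (_ , _ , _ , cells , rows , _) = lat
        (t , e) = cells p q p∈ q∈
        (j , j∈ , e′) = rows i t i∈
    in j , j∈ , trans e′ (sym e)

  col-contains : ∀ {j p q} → j ∈ C → p ∈ R → q ∈ C → OccursInCol M j R (M p q)
  col-contains {j} {p} {q} j∈ p∈ q∈ =
    let (_ , _ , _ , cells , _ , cols , _) = lat
        (t , e) = cells p q p∈ q∈
        (i , i∈ , e′) = cols j t j∈
    in i , i∈ , trans e′ (sym e)

module _ {n} {M : Matrix n} {A B : Subset n} where

  row-symbols-onto : ∀ {i r} → RowInjectiveOn M A B → i ∈ A →
    (∀ {j} → j ∈ B → OccursInRow M r B (M i j)) → ∀ {j′} → j′ ∈ B → OccursInRow M i B (M r j′)
  row-symbols-onto {i} {r} rowInj i∈A inRow-r j′∈B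
    with Injects⇒onto {R = λ j j′ → M r j′ ≡ M i j} (λ j j′ → M r j′ ≟ⁿ M i j)
           (inRow-r , λ j∈ j₂∈ _ e e′ → rowInj i∈A j∈ j₂∈ (trans (sym e) e′)) (≤-reflexive refl) j′∈B
  ... | j , j∈B , e = j , j∈B , sym e

  col-symbols-onto : ∀ {j r} → ColInjectiveOn M A B → ∣ B ∣ ≤ ∣ A ∣ → j ∈ B →
    (∀ {i} → i ∈ A → OccursInRow M r B (M i j)) → ∀ {j′} → j′ ∈ B → OccursInCol M j A (M r j′)
  col-symbols-onto {j} {r} colInj B≤A j∈B inRow-r j′∈B
    with Injects⇒onto {R = λ i j′ → M r j′ ≡ M i j} (λ i j′ → M r j′ ≟ⁿ M i j)
           (inRow-r , λ i∈ i₂∈ _ e e′ → colInj i∈ i₂∈ j∈B (trans (sym e) e′)) B≤A j′∈B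
  ... | i , i∈A , e = i , i∈A , sym e

  row-has-symbol-off-row : ∀ {i r j} → RowInjectiveOn M A B → i ∈ A → j ∈ B →
    ¬ OccursInRow M i B (M r j) → ∃ λ j′ → j′ ∈ B × ¬ OccursInRow M r B (M i j′)
  row-has-symbol-off-row {i} {r} rowInj i∈A j∈B absent
    with all-or-counterexample B (λ j′ → occursInRow? M r B (M i j′))
  ... | inj₁ inRow-r = ⊥-elim (absent (row-symbols-onto rowInj i∈A inRow-r j∈B))
  ... | inj₂ off = off

  col-has-symbol-off-row : ∀ {j r j*} → ColInjectiveOn M A B → ∣ B ∣ ≤ ∣ A ∣ → j ∈ B → j* ∈ B →
    ¬ OccursInCol M j A (M r j*) → ∃ λ i → i ∈ A × ¬ OccursInRow M r B (M i j)
  col-has-symbol-off-row {j} {r} colInj B≤A j∈B j*∈B absent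
    with all-or-counterexample A (λ i → occursInRow? M r B (M i j))
  ... | inj₁ inRow-r = ⊥-elim (absent (col-symbols-onto colInj B≤A j∈B inRow-r j*∈B))
  ... | inj₂ off = off

  row-symbol-absent-from-col : ∀ {r} → RowInjectiveOn M A B → r ∈ A → ∣ A ∣ < ∣ B ∣ →
    ∀ j → ∃ λ j′ → j′ ∈ B × ¬ OccursInCol M j A (M r j′)
  row-symbol-absent-from-col {r} rowInj r∈A A<B j
    with all-or-counterexample B (λ j′ → occursInCol? M j A (M r j′))
  ... | inj₂ absent = absent
  ... | inj₁ present =
    contradiction (Injects⇒∣p∣≤∣q∣ {R = λ j′ i → M i j ≡ M r j′}
                     (present , λ j′∈ j″∈ _ e e′ → rowInj r∈A j′∈ j″∈ (trans (sym e) e′)))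
                  (<⇒≱ A<B)

  col-symbol-absent-from-row : ∀ {c} → ColInjectiveOn M A B → c ∈ B → ∣ B ∣ < ∣ A ∣ →
    ∀ i → ∃ λ i′ → i′ ∈ A × ¬ OccursInRow M i B (M i′ c)
  col-symbol-absent-from-row {c} colInj c∈B B<A i
    with all-or-counterexample A (λ i′ → occursInRow? M i B (M i′ c))
  ... | inj₂ absent = absent
  ... | inj₁ present =
    contradiction (Injects⇒∣p∣≤∣q∣ {R = λ i′ j → M i j ≡ M i′ c}
                     (present , λ i′∈ i″∈ _ e e′ → colInj i′∈ i″∈ c∈B (trans (sym e) e′)))
                  (<⇒≱ B<A)

  IsLatinOn-fromRow : ∀ {r} → ∣ A ∣ ≡ ∣ B ∣ → r ∈ A → RowInjectiveOn M A B → ColInjectiveOn M A B →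
    (∀ {i j} → i ∈ A → j ∈ B → OccursInRow M r B (M i j)) → IsLatinOn M A B
  IsLatinOn-fromRow {r} A≡B r∈A rowInj colInj inRow-r =
    A≡B , symbol , symbol-injective , cells , rows , cols , (λ _ _ _ → rowInj) , (λ _ _ _ → colInj)
    where
    column : Fin ∣ A ∣ → Fin n
    column t = index B (cast A≡B t)
    column∈ : ∀ t → column t ∈ B
    column∈ t = index∈ B _
    column-onto : ∀ {j} → j ∈ B → ∃ λ t → column t ≡ j
    column-onto j∈B with index-surjective B j∈B
    ... | u , e = cast (sym A≡B) u , trans (cong (index B) (cast-involutive A≡B (sym A≡B) u)) e
    symbol : Fin ∣ A ∣ → ℕ
    symbol t = M r (column t)
    symbol-injective : Injective _≡_ _≡_ symbol
    symbol-injective {t} {u} e = cast-injective (index-injective B (rowInj r∈A (column∈ t) (column∈ u) e))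
      where
      cast-injective : cast A≡B t ≡ cast A≡B u → t ≡ u
      cast-injective e′ = trans (sym (cast-involutive (sym A≡B) A≡B t))
                            (trans (cong (cast (sym A≡B)) e′) (cast-involutive (sym A≡B) A≡B u))
    cells : ∀ i j → i ∈ A → j ∈ B → ∃ λ t → M i j ≡ symbol t
    cells i j i∈ j∈ with inRow-r i∈ j∈
    ... | j′ , j′∈ , e with column-onto j′∈
    ...   | t , refl = t , sym e
    rows : ∀ i t → i ∈ A → ∃ λ j → j ∈ B × M i j ≡ symbol t
    rows i t i∈ = row-symbols-onto rowInj i∈ (inRow-r i∈) (column∈ t)
    cols : ∀ j t → j ∈ B → ∃ λ i → i ∈ A × M i j ≡ symbol t
    cols j t j∈ = col-symbols-onto colInj (≤-reflexive (sym A≡B)) j∈ (λ i∈ → inRow-r i∈ j∈) (column∈ t)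

update-cases : ∀ {n} (M : Matrix n) x y σ i j →
  (i ≡ x × j ≡ y × update M x y σ i j ≡ σ) ⊎ (¬ (i ≡ x × j ≡ y) × update M x y σ i j ≡ M i j)
update-cases M x y σ i j with i ≟ᶠ x | j ≟ᶠ y
... | yes i≡x | yes j≡y = inj₁ (i≡x , j≡y , refl)
... | yes _   | no j≢y  = inj₂ (j≢y ∘ proj₂ , refl)
... | no i≢x  | _       = inj₂ (i≢x ∘ proj₁ , refl)

IsLatinOn-update : ∀ {n} {M : Matrix n} {A B : Subset n} {x y r j* σ} →
  ∣ A ∣ ≡ ∣ B ∣ → r ∈ A → r ≢ x → j* ∈ B → σ ≡ M r j* →
  RowInjectiveOn M A B → ColInjectiveOn M A B →
  (∀ {j} → j ∈ B → j ≢ y → M x j ≢ σ) →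
  (∀ {i} → i ∈ A → i ≢ x → M i y ≢ σ) →
  (∀ {i j} → i ∈ A → j ∈ B → ¬ (i ≡ x × j ≡ y) → OccursInRow M r B (M i j)) →
  IsLatinOn (update M x y σ) A B
IsLatinOn-update {M = M} {A} {B} {x} {y} {r} {j*} {σ}
                 A≡B r∈A r≢x j*∈B σ≡ rowInj colInj row-x-fresh col-y-fresh inRow-r =
  IsLatinOn-fromRow A≡B r∈A rowInj′ colInj′ inRow-r′
  where
  M′ : Matrix _
  M′ = update M x y σ
  row-r : ∀ j → M′ r j ≡ M r j
  row-r j with update-cases M x y σ r j
  ... | inj₁ (r≡x , _) = ⊥-elim (r≢x r≡x)
  ... | inj₂ (_ , e) = e
  rowInj′ : RowInjectiveOn M′ A B
  rowInj′ {i} {j₁} {j₂} i∈ j₁∈ j₂∈ e with update-cases M x y σ i j₁ | update-cases M x y σ i j₂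
  ... | inj₁ (_ , refl , _) | inj₁ (_ , refl , _) = refl
  ... | inj₁ (refl , refl , u₁) | inj₂ (ne₂ , u₂) =
    ⊥-elim (row-x-fresh j₂∈ (λ j₂≡y → ne₂ (refl , j₂≡y)) (trans (sym u₂) (trans (sym e) u₁)))
  ... | inj₂ (ne₁ , u₁) | inj₁ (refl , refl , u₂) =
    ⊥-elim (row-x-fresh j₁∈ (λ j₁≡y → ne₁ (refl , j₁≡y)) (trans (sym u₁) (trans e u₂)))
  ... | inj₂ (_ , u₁) | inj₂ (_ , u₂) = rowInj i∈ j₁∈ j₂∈ (trans (sym u₁) (trans e u₂))
  colInj′ : ColInjectiveOn M′ A B
  colInj′ {i₁} {i₂} {j} i₁∈ i₂∈ j∈ e with update-cases M x y σ i₁ j | update-cases M x y σ i₂ j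
  ... | inj₁ (refl , _ , _) | inj₁ (refl , _ , _) = refl
  ... | inj₁ (refl , refl , u₁) | inj₂ (ne₂ , u₂) =
    ⊥-elim (col-y-fresh i₂∈ (λ i₂≡x → ne₂ (i₂≡x , refl)) (trans (sym u₂) (trans (sym e) u₁)))
  ... | inj₂ (ne₁ , u₁) | inj₁ (refl , refl , u₂) =
    ⊥-elim (col-y-fresh i₁∈ (λ i₁≡x → ne₁ (i₁≡x , refl)) (trans (sym u₁) (trans e u₂)))
  ... | inj₂ (_ , u₁) | inj₂ (_ , u₂) = colInj i₁∈ i₂∈ j∈ (trans (sym u₁) (trans e u₂))
  inRow-r′ : ∀ {i j} → i ∈ A → j ∈ B → OccursInRow M′ r B (M′ i j)
  inRow-r′ {i} {j} i∈ j∈ with update-cases M x y σ i j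
  ... | inj₁ (_ , _ , u) = j* , j*∈B , trans (row-r j*) (trans (sym σ≡) (sym u))
  ... | inj₂ (ne , u) with inRow-r i∈ j∈ ne
  ...   | j′ , j′∈ , e = j′ , j′∈ , trans (row-r j′) (trans e (sym u))

module Setting {n} (L′ L : Matrix n) (a b : Fin n) (latL′ : IsLatinOn L′ ⊤ ⊤) (near : IsNearCopyAt L L′ a b)
  (RT CT : Subset n) (π∉T : ¬ (a ∈ RT × b ∈ CT))
  (N : Matrix n) (latN : IsLatinOn N RT CT)
  (k : ℕ) (k≤2 : k ≤ 2) (kNear : IsKNearCopyOn L N RT CT k)
  (aliens-not-native : NoAlienSymbolNative L N RT CT)
  (RS CS : Subset n) (latS : IsLatinOn L RS CS)
  (r : Fin n) (r∈RV : r ∈ RS ∩ RT) (r-hole-free : ∀ j → ¬ Hole L N RT CT r j) where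

  RV CV : Subset n
  RV = RS ∩ RT
  CV = CS ∩ CT

  IsHole : Fin n → Fin n → Set
  IsHole = Hole L N RT CT

  module LatL′ = Latin latL′
  module LatN = Latin latN
  module LatS = Latin latS

  RV⊆RS : RV ⊆ RS
  RV⊆RS = p∩q⊆p RS RT
  RV⊆RT : RV ⊆ RT
  RV⊆RT = p∩q⊆q RS RT
  CV⊆CS : CV ⊆ CS
  CV⊆CS = p∩q⊆p CS CT
  CV⊆CT : CV ⊆ CT
  CV⊆CT = p∩q⊆q CS CT

  r∈RS : r ∈ RS
  r∈RS = RV⊆RS r∈RV
  r∈RT : r ∈ RT
  r∈RT = RV⊆RT r∈RV

  rowInjS : RowInjectiveOn L RV CV
  rowInjS = LatS.row-injective-⊆ RV⊆RS CV⊆CS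
  colInjS : ColInjectiveOn L RV CV
  colInjS = LatS.col-injective-⊆ RV⊆RS CV⊆CS
  rowInjN : RowInjectiveOn N RV CV
  rowInjN = LatN.row-injective-⊆ RV⊆RT CV⊆CT
  colInjN : ColInjectiveOn N RV CV
  colInjN = LatN.col-injective-⊆ RV⊆RT CV⊆CT

  L-row-injective-off-π : ∀ {i j j′} → ¬ (i ≡ a × j ≡ b) → ¬ (i ≡ a × j′ ≡ b) → L i j ≡ L i j′ → j ≡ j′
  L-row-injective-off-π off off′ e =
    LatL′.row-injective ∈⊤ ∈⊤ ∈⊤ (trans (sym (proj₂ near _ _ off)) (trans e (proj₂ near _ _ off′)))

  L-col-injective-off-π : ∀ {i i′ j} → ¬ (i ≡ a × j ≡ b) → ¬ (i′ ≡ a × j ≡ b) → L i j ≡ L i′ j → i ≡ i′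
  L-col-injective-off-π off off′ e =
    LatL′.col-injective ∈⊤ ∈⊤ ∈⊤ (trans (sym (proj₂ near _ _ off)) (trans e (proj₂ near _ _ off′)))

  T-avoids-π : ∀ {i j} → i ∈ RT → j ∈ CT → ¬ (i ≡ a × j ≡ b)
  T-avoids-π i∈ j∈ (refl , refl) = π∉T (i∈ , j∈)

  hole? : ∀ i j → Dec (IsHole i j)
  hole? i j = (i ∈? RT) ×-dec (j ∈? CT) ×-dec ¬? (L i j ≟ⁿ N i j)

  non-hole⇒L≡N : ∀ {i j} → i ∈ RT → j ∈ CT → ¬ IsHole i j → L i j ≡ N i j
  non-hole⇒L≡N {i} {j} i∈ j∈ non-hole = decidable-stable (L i j ≟ⁿ N i j) λ L≢N → non-hole (i∈ , j∈ , L≢N)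

  row-r-native : ∀ {j} → j ∈ CT → L r j ≡ N r j
  row-r-native j∈ = non-hole⇒L≡N r∈RT j∈ (r-hole-free _)

  -- Row r of N contains every symbol of N, and row r of T is native.
  symbol-of-N⇒native : ∀ {i j p q} → i ∈ RT → j ∈ CT → p ∈ RT → q ∈ CT → L i j ≡ N p q → L i j ≡ N i j
  symbol-of-N⇒native {i} {j} i∈ j∈ p∈ q∈ e = non-hole⇒L≡N i∈ j∈ λ hole →
    let (y , y∈ , Nry≡Npq) = LatN.row-contains r∈RT p∈ q∈
    in aliens-not-native i j r y hole r∈RT y∈ (r-hole-free y)
         (trans e (trans (sym Nry≡Npq) (sym (row-r-native y∈))))

  hole : Fin k → Fin n × Fin n
  hole = proj₁ kNear

  hole-index : ∀ {i j} → IsHole i j → ∃ λ t → hole t ≡ (i , j)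
  hole-index h = proj₁ (proj₂ (proj₂ kNear)) _ _ h

  two-holes-cover : ∀ {x₁ y₁ x₂ y₂ x y} → IsHole x₁ y₁ → IsHole x₂ y₂ → ¬ (x₁ ≡ x₂ × y₁ ≡ y₂) →
    IsHole x y → (x ≡ x₁ × y ≡ y₁) ⊎ (x ≡ x₂ × y ≡ y₂)
  two-holes-cover h₁ h₂ h₁≢h₂ h with hole-index h₁ | hole-index h₂ | hole-index h
  ... | t₁ , e₁ | t₂ , e₂ | t , e
    with two-distinct⇒covering k≤2 t₁ t₂ t (λ { refl → h₁≢h₂ (,-injective (trans (sym e₁) e₂)) })
  ...   | inj₁ refl = inj₁ (,-injective (trans (sym e) e₁))
  ...   | inj₂ refl = inj₂ (,-injective (trans (sym e) e₂))

  two-holes⇒k≡2 : ∀ {x₁ y₁ x₂ y₂} → IsHole x₁ y₁ → IsHole x₂ y₂ → ¬ (x₁ ≡ x₂ × y₁ ≡ y₂) → k ≡ 2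
  two-holes⇒k≡2 h₁ h₂ h₁≢h₂ with hole-index h₁ | hole-index h₂
  ... | t₁ , e₁ | t₂ , e₂ =
    two-distinct⇒k≡2 k≤2 t₁ t₂ λ { refl → h₁≢h₂ (,-injective (trans (sym e₁) e₂)) }

  NativeInV : ℕ → Set
  NativeInV σ = ∃ λ p → ∃ λ q → p ∈ RV × q ∈ CV × L p q ≡ σ × N p q ≡ σ

  native-at-r : ∀ {j} → j ∈ CV → NativeInV (L r j)
  native-at-r j∈ = r , _ , r∈RV , j∈ , refl , sym (row-r-native (CV⊆CT j∈))

  -- A native symbol of V missing from a column of V still occurs in that column of N and of S;
  -- unless the occurrence in S is π, both are the same cell, which must then be a hole.
  absent-from-col⇒hole-or-π : ∀ {j σ} → j ∈ CV → NativeInV σ → ¬ OccursInCol L j RV σ →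
    (∃ λ x → IsHole x j × N x j ≡ σ) ⊎ (b ≡ j × a ∈ RS × L a b ≡ σ)
  absent-from-col⇒hole-or-π {j} j∈ (p , q , p∈ , q∈ , Lpq≡σ , Npq≡σ) absent
    with LatN.col-contains (CV⊆CT j∈) (RV⊆RT p∈) (CV⊆CT q∈) | LatS.col-contains (CV⊆CS j∈) (RV⊆RS p∈) (CV⊆CS q∈)
  ... | x , x∈RT , Nxj≡ | ρ , ρ∈RS , Lρj≡ with hole? x j
  ...   | yes h = inj₁ (x , h , trans Nxj≡ Npq≡σ)
  ...   | no non-hole with ρ ≟ᶠ a ×-dec j ≟ᶠ b
  ...     | yes (refl , refl) = inj₂ (refl , ρ∈RS , trans Lρj≡ Lpq≡σ)
  ...     | no off-π = ⊥-elim (absent (x , x∈RV , trans Lxj≡N (trans Nxj≡ Npq≡σ)))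
    where
    Lxj≡N : L x j ≡ N x j
    Lxj≡N = non-hole⇒L≡N x∈RT (CV⊆CT j∈) non-hole
    ρ≡x : ρ ≡ x
    ρ≡x = L-col-injective-off-π off-π (T-avoids-π x∈RT (CV⊆CT j∈))
            (trans Lρj≡ (trans Lpq≡σ (trans (sym Npq≡σ) (trans (sym Nxj≡) (sym Lxj≡N)))))
    x∈RV : x ∈ RV
    x∈RV = x∈p∩q⁺ (subst (_∈ RS) ρ≡x ρ∈RS , x∈RT)

  absent-from-row⇒hole-or-π : ∀ {i σ} → i ∈ RV → NativeInV σ → ¬ OccursInRow L i CV σ →
    (∃ λ y → IsHole i y × N i y ≡ σ) ⊎ (a ≡ i × b ∈ CS × L a b ≡ σ)
  absent-from-row⇒hole-or-π {i} i∈ (p , q , p∈ , q∈ , Lpq≡σ , Npq≡σ) absent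
    with LatN.row-contains (RV⊆RT i∈) (RV⊆RT p∈) (CV⊆CT q∈) | LatS.row-contains (RV⊆RS i∈) (RV⊆RS p∈) (CV⊆CS q∈)
  ... | y , y∈CT , Niy≡ | y′ , y′∈CS , Liy′≡ with hole? i y
  ...   | yes h = inj₁ (y , h , trans Niy≡ Npq≡σ)
  ...   | no non-hole with i ≟ᶠ a ×-dec y′ ≟ᶠ b
  ...     | yes (refl , refl) = inj₂ (refl , y′∈CS , trans Liy′≡ Lpq≡σ)
  ...     | no off-π = ⊥-elim (absent (y , y∈CV , trans Liy≡N (trans Niy≡ Npq≡σ)))
    where
    Liy≡N : L i y ≡ N i y
    Liy≡N = non-hole⇒L≡N (RV⊆RT i∈) y∈CT non-hole
    y′≡y : y′ ≡ y
    y′≡y = L-row-injective-off-π off-π (T-avoids-π (RV⊆RT i∈) y∈CT)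
            (trans Liy′≡ (trans Lpq≡σ (trans (sym Npq≡σ) (trans (sym Niy≡) (sym Liy≡N)))))
    y∈CV : y ∈ CV
    y∈CV = x∈p∩q⁺ (subst (_∈ CS) y′≡y y′∈CS , y∈CT)

  off-row-r⇒π-in-row-r : ∀ {i j} → i ∈ RV → j ∈ CV → ¬ IsHole i j → ¬ OccursInRow L r CV (L i j) →
    a ≡ r × b ∈ CS × L a b ≡ L i j
  off-row-r⇒π-in-row-r i∈ j∈ non-hole off
    with absent-from-row⇒hole-or-π r∈RV
           (_ , _ , i∈ , j∈ , refl , sym (non-hole⇒L≡N (RV⊆RT i∈) (CV⊆CT j∈) non-hole)) off
  ... | inj₁ (y , h , _) = ⊥-elim (r-hole-free y h)
  ... | inj₂ π-in-row-r = π-in-row-r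

  off-row-r⇒hole : r ≢ a → ∀ {i j} → i ∈ RV → j ∈ CV → ¬ OccursInRow L r CV (L i j) → IsHole i j
  off-row-r⇒hole r≢a {i} {j} i∈ j∈ off = decidable-stable (hole? i j) λ non-hole →
    r≢a (sym (proj₁ (off-row-r⇒π-in-row-r i∈ j∈ non-hole off)))

  -- Each line of V lacking a native symbol is charged to π (index zero), holding L a b, or
  -- to a hole of T, whose displaced native is the missing symbol.
  Source : Set
  Source = Fin (suc k)

  sourceRow sourceCol : Source → Fin n
  sourceRow zero = a
  sourceRow (suc t) = proj₁ (hole t)
  sourceCol zero = b
  sourceCol (suc t) = proj₂ (hole t)

  sourceSymbol : Source → ℕ
  sourceSymbol zero = L a b
  sourceSymbol (suc t) = uncurry N (hole t)

  SourceInCol SourceInRow : Fin n → ℕ → Set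
  SourceInCol j σ = Σ Source λ w → sourceCol w ≡ j × sourceSymbol w ≡ σ
  SourceInRow i σ = Σ Source λ w → sourceRow w ≡ i × sourceSymbol w ≡ σ

  absent-from-col⇒source : ∀ {j σ} → j ∈ CV → NativeInV σ → ¬ OccursInCol L j RV σ → SourceInCol j σ
  absent-from-col⇒source j∈ native absent with absent-from-col⇒hole-or-π j∈ native absent
  ... | inj₂ (b≡j , _ , Lab≡σ) = zero , b≡j , Lab≡σ
  ... | inj₁ (_ , h , Nxj≡σ) with hole-index h
  ...   | t , e = suc t , cong proj₂ e , trans (cong (uncurry N) e) Nxj≡σ

  absent-from-row⇒source : ∀ {i σ} → i ∈ RV → NativeInV σ → ¬ OccursInRow L i CV σ → SourceInRow i σ
  absent-from-row⇒source i∈ native absent with absent-from-row⇒hole-or-π i∈ native absent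
  ... | inj₂ (a≡i , _ , Lab≡σ) = zero , a≡i , Lab≡σ
  ... | inj₁ (_ , h , Niy≡σ) with hole-index h
  ...   | t , e = suc t , cong proj₁ e , trans (cong (uncurry N) e) Niy≡σ

  ∣CV∣≤1+k : ∣ RV ∣ < ∣ CV ∣ → ∣ CV ∣ ≤ suc k
  ∣CV∣≤1+k RV<CV = Injects⇒∣p∣≤n {R = λ j w → sourceCol w ≡ j} (source , λ _ _ _ e e′ → trans (sym e) e′)
    where
    source : ∀ {j} → j ∈ CV → ∃ λ w → w ∈ ⊤ × sourceCol w ≡ j
    source {j} j∈ with row-symbol-absent-from-col rowInjS r∈RV RV<CV j
    ... | j′ , j′∈ , absent with absent-from-col⇒source j∈ (native-at-r j′∈) absent
    ...   | w , col≡j , _ = w , ∈⊤ , col≡j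

  -- With a single row, every column of V misses the other ∣ CV ∣ - 1 symbols of row r;
  -- two columns already need four distinct sources.
  single-row-impossible : ∣ RV ∣ ≡ 1 → 3 ≤ ∣ CV ∣ → ⊥
  single-row-impossible RV≡1 3≤CV with distinct-elements 3≤CV
  ... | f , f∈CV , f-injective =
    <⇒≱ (s≤s (s≤s k≤2))
      (four-distinct⇒4≤n (proj₁ w₀₁) (proj₁ w₀₂) (proj₁ w₁₀) (proj₁ w₁₂)
        (other-symbol w₀₁ w₀₂ λ ()) (other-col w₀₁ w₁₀ λ ()) (other-col w₀₁ w₁₂ λ ())
        (other-col w₀₂ w₁₀ λ ()) (other-col w₀₂ w₁₂ λ ()) (other-symbol w₁₀ w₁₂ λ ()))
    where
    distinct-symbols : ∀ {x y} → x ≢ y → L r (f x) ≢ L r (f y)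
    distinct-symbols x≢y e = x≢y (f-injective (rowInjS r∈RV (f∈CV _) (f∈CV _) e))
    w : ∀ x y → x ≢ y → SourceInCol (f x) (L r (f y))
    w x y x≢y = absent-from-col⇒source (f∈CV x) (native-at-r (f∈CV y)) λ (i , i∈ , e) →
      distinct-symbols x≢y (subst (λ i → L i (f x) ≡ L r (f y)) (∣p∣≤1⇒≡ (≤-reflexive RV≡1) i∈ r∈RV) e)
    w₀₁ = w zero (suc zero) λ ()
    w₀₂ = w zero (suc (suc zero)) λ ()
    w₁₀ = w (suc zero) zero λ ()
    w₁₂ = w (suc zero) (suc (suc zero)) λ ()
    other-col : ∀ {x x′ σ σ′} (u : SourceInCol (f x) σ) (v : SourceInCol (f x′) σ′) → x ≢ x′ → proj₁ u ≢ proj₁ v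
    other-col (_ , c , _) (_ , c′ , _) x≢x′ refl = x≢x′ (f-injective (trans (sym c) c′))
    other-symbol : ∀ {j y y′} (u : SourceInCol j (L r (f y))) (v : SourceInCol j (L r (f y′))) → y ≢ y′ →
      proj₁ u ≢ proj₁ v
    other-symbol (_ , _ , s) (_ , _ , s′) y≢y′ refl = distinct-symbols y≢y′ (trans (sym s) s′)

  fewer-rows : 2 ≤ ∣ RV ∣ * ∣ CV ∣ → k < ∣ CV ∣ → ∣ RV ∣ < ∣ CV ∣ → ∣ RV ∣ ≡ k × ∣ CV ∣ ≡ suc k
  fewer-rows 2≤V k<CV RV<CV =
    by-cases (2≤s*suc[k]⇒s≡k ∣ RV ∣ k (≤-pred (subst (∣ RV ∣ <_) CV≡1+k RV<CV)) k≤2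
                (subst (λ c → 2 ≤ ∣ RV ∣ * c) CV≡1+k 2≤V))
    where
    CV≡1+k : ∣ CV ∣ ≡ suc k
    CV≡1+k = ≤-antisym (∣CV∣≤1+k RV<CV) k<CV
    by-cases : ∣ RV ∣ ≡ k ⊎ (∣ RV ∣ ≡ 1 × k ≡ 2) → ∣ RV ∣ ≡ k × ∣ CV ∣ ≡ suc k
    by-cases (inj₁ RV≡k) = RV≡k , CV≡1+k
    by-cases (inj₂ (RV≡1 , k≡2)) =
      ⊥-elim (single-row-impossible RV≡1 (≤-trans (≤-reflexive (cong suc (sym k≡2))) k<CV))

  hole-free-col : k < ∣ CV ∣ → ∃ λ j₀ → j₀ ∈ CV × ∀ i → ¬ IsHole i j₀
  hole-free-col k<CV with all-or-counterexample CV (λ j → any? (λ i → hole? i j))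
  ... | inj₂ (j₀ , j₀∈ , no-hole) = j₀ , j₀∈ , λ i h → no-hole (i , h)
  ... | inj₁ has-hole =
    contradiction (Injects⇒∣p∣≤n {R = λ j t → proj₂ (hole t) ≡ j} (index-of , λ _ _ _ e e′ → trans (sym e) e′))
                  (<⇒≱ k<CV)
    where
    index-of : ∀ {j} → j ∈ CV → ∃ λ t → t ∈ ⊤ × proj₂ (hole t) ≡ j
    index-of j∈ with has-hole j∈
    ... | _ , h with hole-index h
    ...   | t , e = t , ∈⊤ , cong proj₂ e

  -- Dual to ∣CV∣≤1+k, with the symbols of a hole-free column j₀ in place of those of row r.
  fewer-cols-impossible : k < ∣ CV ∣ → ∣ CV ∣ < ∣ RV ∣ → ⊥
  fewer-cols-impossible k<CV CV<RV with hole-free-col k<CV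
  ... | j₀ , j₀∈ , j₀-hole-free =
    <⇒≱ CV<RV
      (≤-trans (Injects⇒∣p∣≤n {R = λ i w → sourceRow w ≡ i} (source , λ _ _ _ e e′ → trans (sym e) e′)) k<CV)
    where
    source : ∀ {i} → i ∈ RV → ∃ λ w → w ∈ ⊤ × sourceRow w ≡ i
    source {i} i∈ with col-symbol-absent-from-row colInjS j₀∈ CV<RV i
    ... | i′ , i′∈ , absent
      with absent-from-row⇒source i∈
             (_ , _ , i′∈ , j₀∈ , refl , sym (non-hole⇒L≡N (RV⊆RT i′∈) (CV⊆CT j₀∈) (j₀-hole-free i′))) absent
    ...   | w , row≡i , _ = w , ∈⊤ , row≡i

  Closed : Set
  Closed = ∀ {i y j} → i ∈ RV → y ∈ CT → j ∈ CV → N i y ≡ N r j → y ∈ CS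

  Leak : Set
  Leak = ∃ λ i → i ∈ RV × ∃ λ y → y ∈ CT × y ∉ CS × ∃ λ j → j ∈ CV × N i y ≡ N r j

  closed-or-leak : Closed ⊎ Leak
  closed-or-leak
    with any? (λ i → (i ∈? RV) ×-dec any? λ y → (y ∈? CT) ×-dec ¬? (y ∈? CS) ×-dec
                                        any? λ j → (j ∈? CV) ×-dec (N i y ≟ⁿ N r j))
  ... | yes leak = inj₂ leak
  ... | no no-leak = inj₁ λ i∈ y∈ j∈ e →
    decidable-stable (_ ∈? CS) λ y∉ → no-leak (_ , i∈ , _ , y∈ , y∉ , _ , j∈ , e)

  Closed⇒IsLatinOn : ∣ RV ∣ ≡ ∣ CV ∣ → Closed → IsLatinOn N RV CV
  Closed⇒IsLatinOn RV≡CV closed = IsLatinOn-fromRow RV≡CV r∈RV rowInjN colInjN λ i∈ j∈ →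
    row-symbols-onto rowInjN r∈RV (row-r-symbols-in-row i∈) j∈
    where
    row-r-symbols-in-row : ∀ {i} → i ∈ RV → ∀ {j} → j ∈ CV → OccursInRow N i CV (N r j)
    row-r-symbols-in-row i∈ j∈ with LatN.row-contains (RV⊆RT i∈) r∈RT (CV⊆CT j∈)
    ... | y , y∈CT , e = y , x∈p∩q⁺ (closed i∈ y∈CT j∈ e , y∈CT) , e

  closed⇒V≡T : 2 ≤ ∣ RV ∣ → IsNInfinityOn N RT CT → ∣ RV ∣ ≡ ∣ CV ∣ → Closed → RV ≡ RT × CV ≡ CT
  closed⇒V≡T 2≤RV N∞ RV≡CV closed with suc ∣ RV ∣ ≤? ∣ RT ∣
  ... | yes RV<RT = ⊥-elim (N∞ RV CV RV⊆RT CV⊆CT 2≤RV RV<RT (Closed⇒IsLatinOn RV≡CV closed))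
  ... | no RV≮RT =
    ⊆∧∣q∣≤∣p∣⇒p≡q RV⊆RT RT≤RV ,
    ⊆∧∣q∣≤∣p∣⇒p≡q CV⊆CT (≤-trans (≤-reflexive (sym (proj₁ latN))) (≤-trans RT≤RV (≤-reflexive RV≡CV)))
    where
    RT≤RV : ∣ RT ∣ ≤ ∣ RV ∣
    RT≤RV = ≤-pred (≰⇒> RV≮RT)

  Conclusion : Set
  Conclusion =
    (RS ∩ RT ≡ RT × CS ∩ CT ≡ CT)
    ⊎ (∣ RS ∩ RT ∣ ≡ k × ∣ CS ∩ CT ∣ ≡ suc k)
    ⊎ (k ≡ 2 ×
       Σ (Fin n) λ x₁ → Σ (Fin n) λ y₁ → Σ (Fin n) λ x₂ → Σ (Fin n) λ y₂ →
         Hole L N RT CT x₁ y₁ × Hole L N RT CT x₂ y₂ × ¬ (x₁ ≡ x₂ × y₁ ≡ y₂) ×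
         (x₁ ∈ RS ∩ RT × y₁ ∈ CS ∩ CT) ×
         ¬ (x₂ ∈ RS ∩ RT × y₂ ∈ CS ∩ CT) ×
         IsLatinOn (update N x₁ y₁ (N x₂ y₂)) (RS ∩ RT) (CS ∩ CT) ×
         ((x₁ ≡ x₂ × b ≡ y₁) ⊎ (y₁ ≡ y₂ × a ≡ x₁)))

  -- The symbol σ of row r of V reappears in row i₀ of N outside S. Then some column j of V
  -- lacks σ in N, σ sits in that column of N at a row x₂ outside V, and σ has to escape V
  -- through a hole or through π both in row i₀ and in column j.
  module Leaking (RV≡CV : ∣ RV ∣ ≡ ∣ CV ∣) (2≤CV : 2 ≤ ∣ CV ∣) {i₀ y₀ j*}
    (i₀∈RV : i₀ ∈ RV) (y₀∈CT : y₀ ∈ CT) (y₀∉CS : y₀ ∉ CS) (j*∈CV : j* ∈ CV) (e₀ : N i₀ y₀ ≡ N r j*) where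

    σ : ℕ
    σ = N r j*

    σ-native : NativeInV σ
    σ-native = r , j* , r∈RV , j*∈CV , row-r-native (CV⊆CT j*∈CV) , refl

    σ-in-row-i₀-only-at-y₀ : ∀ {y} → y ∈ CT → N i₀ y ≡ σ → y ≡ y₀
    σ-in-row-i₀-only-at-y₀ y∈ e = LatN.row-injective (RV⊆RT i₀∈RV) y∈ y₀∈CT (trans e (sym e₀))

    N-row-i₀-lacks-σ : ∀ {j} → j ∈ CV → N i₀ j ≢ σ
    N-row-i₀-lacks-σ j∈ e = y₀∉CS (subst (_∈ CS) (σ-in-row-i₀-only-at-y₀ (CV⊆CT j∈) e) (CV⊆CS j∈))

    L≡σ⇒N≡σ : ∀ {i j} → i ∈ RV → j ∈ CV → L i j ≡ σ → N i j ≡ σ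
    L≡σ⇒N≡σ i∈ j∈ e = trans (sym (symbol-of-N⇒native (RV⊆RT i∈) (CV⊆CT j∈) r∈RT (CV⊆CT j*∈CV) e)) e

    L-row-i₀-lacks-σ : ¬ OccursInRow L i₀ CV σ
    L-row-i₀-lacks-σ (_ , j∈ , e) = N-row-i₀-lacks-σ j∈ (L≡σ⇒N≡σ i₀∈RV j∈ e)

    opaque
      σ-free-col : ∃ λ j → j ∈ CV × ¬ OccursInCol N j RV σ
      σ-free-col with all-or-counterexample CV (λ j → occursInCol? N j RV σ)
      ... | inj₂ free = free
      ... | inj₁ present =
        contradiction (Injects⇒∣p∣≤∣q∣ {R = λ j i → N i j ≡ σ} (present′ , λ j∈ j′∈ i∈ e e′ →
                         LatN.row-injective (RV⊆RT (p─q⊆p _ _ i∈)) (CV⊆CT j∈) (CV⊆CT j′∈) (trans e (sym e′))))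
                      (<⇒≱ (<-≤-trans (x∈p⇒∣p-x∣<∣p∣ i₀∈RV) (≤-reflexive RV≡CV)))
        where
        present′ : ∀ {j} → j ∈ CV → ∃ λ i → i ∈ RV - i₀ × N i j ≡ σ
        present′ j∈ with present j∈
        ... | i , i∈ , e = i , x∈p∧x≢y⇒x∈p-y i∈ (λ { refl → N-row-i₀-lacks-σ j∈ e }) , e

    j : Fin n
    j = proj₁ σ-free-col
    j∈CV : j ∈ CV
    j∈CV = proj₁ (proj₂ σ-free-col)
    N-col-j-lacks-σ : ¬ OccursInCol N j RV σ
    N-col-j-lacks-σ = proj₂ (proj₂ σ-free-col)

    L-col-j-lacks-σ : ¬ OccursInCol L j RV σ
    L-col-j-lacks-σ (i , i∈ , e) = N-col-j-lacks-σ (i , i∈ , L≡σ⇒N≡σ i∈ j∈CV e)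

    σ-in-col-j : OccursInCol N j RT σ
    σ-in-col-j = LatN.col-contains (CV⊆CT j∈CV) r∈RT (CV⊆CT j*∈CV)
    x₂ : Fin n
    x₂ = proj₁ σ-in-col-j
    x₂∈RT : x₂ ∈ RT
    x₂∈RT = proj₁ (proj₂ σ-in-col-j)
    Nx₂j≡σ : N x₂ j ≡ σ
    Nx₂j≡σ = proj₂ (proj₂ σ-in-col-j)
    x₂∉RV : x₂ ∉ RV
    x₂∉RV x₂∈ = N-col-j-lacks-σ (x₂ , x₂∈ , Nx₂j≡σ)

    hole-or-π-in-row-i₀ : IsHole i₀ y₀ ⊎ (a ≡ i₀ × b ∈ CS × L a b ≡ σ)
    hole-or-π-in-row-i₀ with absent-from-row⇒hole-or-π i₀∈RV σ-native L-row-i₀-lacks-σ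
    ... | inj₁ (y , h , e) = inj₁ (subst (IsHole i₀) (σ-in-row-i₀-only-at-y₀ (proj₁ (proj₂ h)) e) h)
    ... | inj₂ π-in-row = inj₂ π-in-row

    hole-or-π-in-col-j : IsHole x₂ j ⊎ (b ≡ j × a ∈ RS × L a b ≡ σ)
    hole-or-π-in-col-j with absent-from-col⇒hole-or-π j∈CV σ-native L-col-j-lacks-σ
    ... | inj₁ (x , h , e) =
      inj₁ (subst (λ x → IsHole x j) (LatN.col-injective (proj₁ h) x₂∈RT (CV⊆CT j∈CV) (trans e (sym Nx₂j≡σ))) h)
    ... | inj₂ π-in-col = inj₂ π-in-col

    Lrj*≡σ : L r j* ≡ σ
    Lrj*≡σ = row-r-native (CV⊆CT j*∈CV)

    row-i₀-off-row-r : ∃ λ j₁ → j₁ ∈ CV × ¬ OccursInRow L r CV (L i₀ j₁)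
    row-i₀-off-row-r = row-has-symbol-off-row rowInjS i₀∈RV j*∈CV
      (subst (λ τ → ¬ OccursInRow L i₀ CV τ) (sym Lrj*≡σ) L-row-i₀-lacks-σ)

    col-j-off-row-r : ∃ λ i₁ → i₁ ∈ RV × ¬ OccursInRow L r CV (L i₁ j)
    col-j-off-row-r = col-has-symbol-off-row colInjS (≤-reflexive (sym RV≡CV)) j∈CV j*∈CV
      (subst (λ τ → ¬ OccursInCol L j RV τ) (sym Lrj*≡σ) L-col-j-lacks-σ)

    -- If π is not in row r and one hole of T lies outside V, the entries of row i₀ and of
    -- column j that row r lacks must both sit in the other hole, which is therefore (i₀ , j).
    other-hole : r ≢ a → ∀ {x′ y′} → IsHole x′ y′ → ¬ (x′ ∈ RV × y′ ∈ CV) → N x′ y′ ≡ σ →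
      IsHole i₀ j × k ≡ 2 × IsLatinOn (update N i₀ j (N x′ y′)) RV CV
    other-hole r≢a {x′} {y′} h′ h′∉V Nh′≡σ with row-i₀-off-row-r | col-j-off-row-r
    ... | j₁ , j₁∈ , off₁ | i₁ , i₁∈ , off₂
      with two-holes-cover h′ (off-row-r⇒hole r≢a i₀∈RV j₁∈ off₁) (λ { (refl , refl) → h′∉V (i₀∈RV , j₁∈) })
                          (off-row-r⇒hole r≢a i₁∈ j∈CV off₂)
    ...   | inj₁ (refl , refl) = ⊥-elim (h′∉V (i₁∈ , j∈CV))
    ...   | inj₂ (refl , refl) =
      hole₀ , two-holes⇒k≡2 h′ hole₀ h′≢hole₀ ,
      subst (λ τ → IsLatinOn (update N i₀ j τ) RV CV) (sym Nh′≡σ) latin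
      where
      hole₀ : IsHole i₀ j
      hole₀ = off-row-r⇒hole r≢a i₀∈RV j∈CV off₁
      h′≢hole₀ : ¬ (x′ ≡ i₀ × y′ ≡ j)
      h′≢hole₀ (refl , refl) = h′∉V (i₀∈RV , j∈CV)
      only-hole-in-V : ∀ {i j′} → i ∈ RV → j′ ∈ CV → IsHole i j′ → i ≡ i₀ × j′ ≡ j
      only-hole-in-V i∈ j′∈ h with two-holes-cover h′ hole₀ h′≢hole₀ h
      ... | inj₁ (refl , refl) = ⊥-elim (h′∉V (i∈ , j′∈))
      ... | inj₂ at-hole₀ = at-hole₀
      in-row-r : ∀ {i j′} → i ∈ RV → j′ ∈ CV → ¬ (i ≡ i₀ × j′ ≡ j) → OccursInRow N r CV (N i j′)
      in-row-r {i} {j′} i∈ j′∈ not-hole₀ with occursInRow? L r CV (L i j′)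
      ... | no off = ⊥-elim (not-hole₀ (only-hole-in-V i∈ j′∈ (off-row-r⇒hole r≢a i∈ j′∈ off)))
      ... | yes (j″ , j″∈ , e) = j″ , j″∈ , trans (sym (row-r-native (CV⊆CT j″∈))) (trans e Lij′≡N)
        where
        Lij′≡N : L i j′ ≡ N i j′
        Lij′≡N = symbol-of-N⇒native (RV⊆RT i∈) (CV⊆CT j′∈) r∈RT (CV⊆CT j″∈)
                   (trans (sym e) (row-r-native (CV⊆CT j″∈)))
      latin : IsLatinOn (update N i₀ j σ) RV CV
      latin = IsLatinOn-update RV≡CV r∈RV (λ { refl → r-hole-free j hole₀ }) j*∈CV refl rowInjN colInjN
                (λ j′∈ _ → N-row-i₀-lacks-σ j′∈) (λ i∈ _ e → N-col-j-lacks-σ (_ , i∈ , e)) in-row-r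

    -- With both holes outside V, π lies in row r, so a column j′ ≠ j of V is free of holes and
    -- of π and contains every native symbol of V: those of row r and a symbol τ that row r
    -- lacks, more than ∣ RV ∣ = ∣ CV ∣ symbols.
    two-outer-holes-impossible : IsHole i₀ y₀ → IsHole x₂ j → ⊥
    two-outer-holes-impossible h₀ h₂ =
      <⇒≱ (<-≤-trans (x∈p⇒∣p-x∣<∣p∣ iτ∈) (≤-reflexive RV≡CV))
          (Injects⇒∣p∣≤∣q∣ {R = λ j″ i → L i j′ ≡ L r j″} (in-col-j′-off-iτ , λ j″∈ j‴∈ _ e e′ →
             rowInjS r∈RV j″∈ j‴∈ (trans (sym e) e′)))
      where
      holes-outside : ∀ {x y} → IsHole x y → (x ≡ i₀ × y ≡ y₀) ⊎ (x ≡ x₂ × y ≡ j)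
      holes-outside = two-holes-cover h₀ h₂ λ (i₀≡x₂ , _) → x₂∉RV (subst (_∈ RV) i₀≡x₂ i₀∈RV)
      V-hole-free : ∀ {i j″} → i ∈ RV → j″ ∈ CV → ¬ IsHole i j″
      V-hole-free i∈ j″∈ h with holes-outside h
      ... | inj₁ (_ , refl) = y₀∉CS (CV⊆CS j″∈)
      ... | inj₂ (refl , _) = x₂∉RV i∈
      j₁ : Fin n
      j₁ = proj₁ row-i₀-off-row-r
      j₁∈ : j₁ ∈ CV
      j₁∈ = proj₁ (proj₂ row-i₀-off-row-r)
      τ-off-row-r : ¬ OccursInRow L r CV (L i₀ j₁)
      τ-off-row-r = proj₂ (proj₂ row-i₀-off-row-r)
      τ-native : NativeInV (L i₀ j₁)
      τ-native = i₀ , j₁ , i₀∈RV , j₁∈ , refl ,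
                 sym (non-hole⇒L≡N (RV⊆RT i₀∈RV) (CV⊆CT j₁∈) (V-hole-free i₀∈RV j₁∈))
      a≡r : a ≡ r
      a≡r = proj₁ (off-row-r⇒π-in-row-r i₀∈RV j₁∈ (V-hole-free i₀∈RV j₁∈) τ-off-row-r)
      other-col : ∃ λ j′ → j′ ∈ CV × j′ ≢ j
      other-col = 2≤∣p∣⇒∃≢ {p = CV} 2≤CV j
      j′ : Fin n
      j′ = proj₁ other-col
      j′∈ : j′ ∈ CV
      j′∈ = proj₁ (proj₂ other-col)
      col-j′-hole-free : ∀ i → ¬ IsHole i j′
      col-j′-hole-free i h with holes-outside h
      ... | inj₁ (_ , j′≡y₀) = y₀∉CS (subst (_∈ CS) j′≡y₀ (CV⊆CS j′∈))
      ... | inj₂ (_ , j′≡j) = proj₂ (proj₂ other-col) j′≡j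
      in-col-j′ : ∀ {τ} → NativeInV τ → OccursInCol L j′ RV τ
      in-col-j′ {τ} native with occursInCol? L j′ RV τ
      ... | yes present = present
      ... | no absent with absent-from-col⇒hole-or-π j′∈ native absent
      ...   | inj₁ (i , h , _) = ⊥-elim (col-j′-hole-free i h)
      ...   | inj₂ (b≡j′ , _) = ⊥-elim (π∉T (subst (_∈ RT) (sym a≡r) r∈RT , subst (_∈ CT) (sym b≡j′) (CV⊆CT j′∈)))
      iτ : Fin n
      iτ = proj₁ (in-col-j′ τ-native)
      iτ∈ : iτ ∈ RV
      iτ∈ = proj₁ (proj₂ (in-col-j′ τ-native))
      in-col-j′-off-iτ : ∀ {j″} → j″ ∈ CV → ∃ λ i → i ∈ RV - iτ × L i j′ ≡ L r j″
      in-col-j′-off-iτ {j″} j″∈ =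
        let (i , i∈ , e) = in-col-j′ (native-at-r j″∈)
        in i , x∈p∧x≢y⇒x∈p-y i∈ (λ i≡iτ →
                 τ-off-row-r (j″ , j″∈ , trans (sym e) (trans (cong (λ z → L z j′) i≡iτ) eτ))) , e
        where
        eτ : L iτ j′ ≡ L i₀ j₁
        eτ = proj₂ (proj₂ (in-col-j′ τ-native))

    hole-in-row-π-in-col : IsHole i₀ y₀ → b ≡ j → Conclusion
    hole-in-row-π-in-col h₀ b≡j =
      let (hole₀ , k≡2 , latin) = other-hole r≢a h₀ (λ (_ , y₀∈CV) → y₀∉CS (CV⊆CS y₀∈CV)) e₀
      in inj₂ (inj₂ (k≡2 , i₀ , j , i₀ , y₀ , hole₀ , h₀ ,
                     (λ (_ , j≡y₀) → y₀∉CS (subst (_∈ CS) j≡y₀ (CV⊆CS j∈CV))) ,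
                     (i₀∈RV , j∈CV) , (λ (_ , y₀∈CV) → y₀∉CS (CV⊆CS y₀∈CV)) , latin , inj₁ (refl , b≡j)))
      where
      r≢a : r ≢ a
      r≢a r≡a = π∉T (subst (_∈ RT) r≡a r∈RT , subst (_∈ CT) (sym b≡j) (CV⊆CT j∈CV))

    π-in-row-hole-in-col : a ≡ i₀ → b ∈ CS → L a b ≡ σ → IsHole x₂ j → Conclusion
    π-in-row-hole-in-col a≡i₀ b∈CS Lab≡σ h₂ =
      let (hole₀ , k≡2 , latin) = other-hole r≢a h₂ (λ (x₂∈ , _) → x₂∉RV x₂∈) Nx₂j≡σ
      in inj₂ (inj₂ (k≡2 , i₀ , j , x₂ , j , hole₀ , h₂ ,
                     (λ (i₀≡x₂ , _) → x₂∉RV (subst (_∈ RV) i₀≡x₂ i₀∈RV)) ,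
                     (i₀∈RV , j∈CV) , (λ (x₂∈ , _) → x₂∉RV x₂∈) , latin , inj₂ (refl , a≡i₀)))
      where
      r≢a : r ≢ a
      r≢a r≡a = π∉T (subst (_∈ RT) (sym a≡i₀) (RV⊆RT i₀∈RV) , subst (_∈ CT) (sym b≡j*) (CV⊆CT j*∈CV))
        where
        b≡j* : b ≡ j*
        b≡j* = LatS.row-injective r∈RS b∈CS (CV⊆CS j*∈CV)
                 (trans (cong (λ z → L z b) r≡a) (trans Lab≡σ (sym Lrj*≡σ)))

    conclusion : Conclusion
    conclusion = by-cases hole-or-π-in-row-i₀ hole-or-π-in-col-j
      where
      by-cases : IsHole i₀ y₀ ⊎ (a ≡ i₀ × b ∈ CS × L a b ≡ σ) → IsHole x₂ j ⊎ (b ≡ j × a ∈ RS × L a b ≡ σ) →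
                 Conclusion
      by-cases (inj₁ h₀) (inj₁ h₂) = ⊥-elim (two-outer-holes-impossible h₀ h₂)
      by-cases (inj₁ h₀) (inj₂ (b≡j , _)) = hole-in-row-π-in-col h₀ b≡j
      by-cases (inj₂ (a≡i₀ , b∈CS , Lab≡σ)) (inj₁ h₂) = π-in-row-hole-in-col a≡i₀ b∈CS Lab≡σ h₂
      by-cases (inj₂ (a≡i₀ , _)) (inj₂ (b≡j , _)) =
        ⊥-elim (π∉T (subst (_∈ RT) (sym a≡i₀) (RV⊆RT i₀∈RV) , subst (_∈ CT) (sym b≡j) (CV⊆CT j∈CV)))

  equal-size : 2 ≤ ∣ RV ∣ * ∣ CV ∣ → IsNInfinityOn N RT CT → ∣ RV ∣ ≡ ∣ CV ∣ → Conclusion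
  equal-size 2≤V N∞ RV≡CV with closed-or-leak
  ... | inj₁ closed = inj₁ (closed⇒V≡T 2≤RV N∞ RV≡CV closed)
    where
    2≤RV : 2 ≤ ∣ RV ∣
    2≤RV = 2≤s*s⇒2≤s ∣ RV ∣ (subst (λ c → 2 ≤ ∣ RV ∣ * c) (sym RV≡CV) 2≤V)
  ... | inj₂ (_ , i₀∈RV , _ , y₀∈CT , y₀∉CS , _ , j*∈CV , e₀) =
    Leaking.conclusion RV≡CV 2≤CV i₀∈RV y₀∈CT y₀∉CS j*∈CV e₀
    where
    2≤CV : 2 ≤ ∣ CV ∣
    2≤CV = 2≤s*s⇒2≤s ∣ CV ∣ (subst (λ s → 2 ≤ s * ∣ CV ∣) RV≡CV 2≤V)

  conclusion : 2 ≤ ∣ RV ∣ * ∣ CV ∣ → k < ∣ CV ∣ → IsNInfinityOn N RT CT → Conclusion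
  conclusion 2≤V k<CV N∞ with <-cmp ∣ RV ∣ ∣ CV ∣
  ... | tri< RV<CV _ _ = inj₂ (inj₁ (fewer-rows 2≤V k<CV RV<CV))
  ... | tri≈ _ RV≡CV _ = equal-size 2≤V N∞ RV≡CV
  ... | tri> _ _ CV<RV = ⊥-elim (fewer-cols-impossible k<CV CV<RV)

lemma3p2 : ∀ {n} (L′ L : Matrix n) (a b : Fin n) →
    IsLatinOn L′ ⊤ ⊤ →
    IsNearCopyAt L L′ a b →
    (RT CT : Subset n) →
    ¬ (a ∈ RT × b ∈ CT) →
    (N : Matrix n) → IsLatinOn N RT CT → IsNInfinityOn N RT CT →
    (k : ℕ) → k ≤ 2 → IsKNearCopyOn L N RT CT k →
    NoAlienSymbolNative L N RT CT →
    (RS CS : Subset n) → IsLatinOn L RS CS →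
    2 ≤ ∣ RS ∩ RT ∣ * ∣ CS ∩ CT ∣ →
    k < ∣ CS ∩ CT ∣ →
    (∃ λ r → r ∈ RS ∩ RT × (∀ j → ¬ Hole L N RT CT r j)) →
    (RS ∩ RT ≡ RT × CS ∩ CT ≡ CT)
    ⊎ (∣ RS ∩ RT ∣ ≡ k × ∣ CS ∩ CT ∣ ≡ suc k)
    ⊎ (k ≡ 2 ×
       Σ (Fin n) λ x₁ → Σ (Fin n) λ y₁ → Σ (Fin n) λ x₂ → Σ (Fin n) λ y₂ →
         Hole L N RT CT x₁ y₁ × Hole L N RT CT x₂ y₂ × ¬ (x₁ ≡ x₂ × y₁ ≡ y₂) ×
         (x₁ ∈ RS ∩ RT × y₁ ∈ CS ∩ CT) ×
         ¬ (x₂ ∈ RS ∩ RT × y₂ ∈ CS ∩ CT) ×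
         IsLatinOn (update N x₁ y₁ (N x₂ y₂)) (RS ∩ RT) (CS ∩ CT) ×
         ((x₁ ≡ x₂ × b ≡ y₁) ⊎ (y₁ ≡ y₂ × a ≡ x₁)))
lemma3p2 L′ L a b latL′ near RT CT π∉T N latN N∞ k k≤2 kNear aliens-not-native RS CS latS 2≤V k<CV
         (r , r∈RV , r-hole-free) =
  Setting.conclusion L′ L a b latL′ near RT CT π∉T N latN k k≤2 kNear aliens-not-native RS CS latS
                     r r∈RV r-hole-free 2≤V k<CV N∞
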